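{- Let $a,b$ be relatively prime integers with $1<a<b$, let $S=\langle a,b\rangle$, and let $(u,v)$ be the definitely least solution of $ax+by=1$. Then \[\#\{I_{i,a}(S): I_{i,a}(S)\neq\varnothing,\ i\in[1,a-1]\}=|v|.\]
   Context: $\langle a,b\rangle=\{\lambda_1a+\lambda_2b:\lambda_1,\lambda_2\in\mathbb{N}\}$. $I(S)$ is the set of isolated gaps of $S$ (elements $x\in\mathbb{N}\setminus S$ with $x-1,x+1\in S$). For $i\in\{1,\dots,a-1\}$, $I_{i,a}(S)=\{s\in I(S): s\equiv i\pmod a\}$. The definitely least solution $(u,v)$ of $ax+by=1$ is the integer solution for which both $|u|$ and $|v|$ are least possible; it is unique, and is the unique solution with $|u|\le b/2$, $|v|\le a/2$. -}

module Defs where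

open import Data.Nat using (ℕ; suc; _+_; _*_; _≤_; _<_)
open import Data.Integer as ℤ using (ℤ; +_; ∣_∣)
open import Data.Product using (Σ; ∃; _×_)
open import Data.List using (List; length)
open import Data.List.Membership.Propositional using (_∈_)
open import Data.List.Relation.Unary.Unique.Propositional using (Unique)
open import Relation.Binary.PropositionalEquality using (_≡_)
open import Relation.Nullary using (¬_)
open import Function.Bundles using (_⇔_)

InS : ℕ → ℕ → ℕ → Set
InS a b x = ∃ λ l₁ → ∃ λ l₂ → l₁ * a + l₂ * b ≡ x

IsolatedGap : ℕ → ℕ → ℕ → Set
IsolatedGap a b x =
  ¬ InS a b x × (∃ λ y → x ≡ suc y × InS a b y) × InS a b (suc x)

-- I_{i,a}(S) ≠ ∅ : some isolated gap s with s ≡ i (mod a)  (here 0 ≤ i < a, so s = k*a + i)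
IiaNonempty : ℕ → ℕ → ℕ → Set
IiaNonempty a b i = ∃ λ s → IsolatedGap a b s × ∃ λ k → s ≡ k * a + i

DefinitelyLeast : ℕ → ℕ → ℤ → ℤ → Set
DefinitelyLeast a b u v =
  (+ a) ℤ.* u ℤ.+ (+ b) ℤ.* v ≡ + 1 ×
  (∀ (x y : ℤ) → (+ a) ℤ.* x ℤ.+ (+ b) ℤ.* y ≡ + 1 → ∣ u ∣ ≤ ∣ x ∣ × ∣ v ∣ ≤ ∣ y ∣)

HasCard : (ℕ → Set) → ℕ → Set
HasCard P n = Σ (List ℕ) λ L → Unique L × (∀ i → (i ∈ L) ⇔ P i) × length L ≡ n

-- Write w = ∣v∣. Comparing (u,v) with the solutions (u ± b, v ∓ a) gives 2w ≤ a, and the sign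
-- of v turns a u + b v = 1 into b w = 1 + a (m+1) or a (m+1) = 1 + b w. For 0 < t < a the number
-- t b − a is the largest gap in the residue class of t b. Put c = a − w: for c ≤ t < a both
-- neighbours of t b − a lie in ⟨a,b⟩, by trading b w for a (m+1) ± 1. Conversely an isolated gap s
-- has a neighbour l₁ a + l₂ b (above s if v > 0, below if v < 0); if l₂ ≥ w the same trade puts s
-- itself in ⟨a,b⟩, so l₂ < w and s ≡ (c + l₂) b (mod a). As b is invertible mod a, the w classes
-- of t b with c ≤ t < a are pairwise distinct.

module Submission where

open import Defs
open import Data.Nat using (ℕ; _≤_; _<_)
open import Data.Nat.Coprimality using (Coprime)
open import Data.Integer using (ℤ; ∣_∣)
open import Data.Product using (_×_)

open import Data.Nat using (zero; suc; z<s; _+_; _*_; _∸_; _%_; _/_; NonZero; >-nonZero; >-nonZero⁻¹; ≢-nonZero⁻¹; _≤?_)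
open import Data.Nat.Properties
open import Data.Nat.DivMod using (m≡m%n+[m/n]*n; m%n<n; m<n⇒m%n≡m; [m+kn]%n≡m%n; m/n≡1+[m∸n]/n)
open import Data.Nat.Divisibility using (_∣_; divides; n∣m*n; ∣m+n∣m⇒∣n; n∣m⇒m%n≡0; m%n≡0⇒n∣m)
open import Data.Nat.Coprimality using (coprime-divisor)
open import Data.Nat.Tactic.RingSolver using (solve; solve-∀)
open import Data.Integer as ℤ using (+_; -[1+_]; _⊖_)
import Data.Integer.Properties as ℤ
import Data.Integer.Tactic.RingSolver as ℤ-Solver
open import Data.List using ([]; _∷_; applyUpTo)
open import Data.List.Membership.Propositional using (_∈_)
open import Data.List.Membership.Propositional.Properties using (∈-applyUpTo⁺; ∈-applyUpTo⁻)
open import Data.List.Relation.Unary.Unique.Propositional.Properties using (applyUpTo⁺₁)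
open import Data.List.Properties using (length-applyUpTo)
open import Data.Product using (∃; _,_; proj₂)
open import Data.Empty using (⊥-elim)
open import Data.Sum using (inj₁; inj₂)
open import Relation.Nullary using (¬_; yes; no; contradiction)
open import Relation.Binary.PropositionalEquality
open import Function.Bundles using (mk⇔)

open ≡-Reasoning

+*-[1+] : ∀ a n → + a ℤ.* -[1+ n ] ≡ ℤ.- + (a * suc n)
+*-[1+] a n = trans (sym (ℤ.neg-distribʳ-* (+ a) (+ suc n))) (cong ℤ.-_ (sym (ℤ.pos-* a (suc n))))

m-n≡k⇒m≡k+n : ∀ m n k → + m ℤ.- + n ≡ + k → m ≡ k + n
m-n≡k⇒m≡k+n m n k eq = ℤ.+-injective (begin
  + m                    ≡⟨ i≡[i-j]+j (+ m) (+ n) ⟩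
  (+ m ℤ.- + n) ℤ.+ + n  ≡⟨ cong (ℤ._+ + n) eq ⟩
  + k ℤ.+ + n            ≡⟨ ℤ.pos-+ k n ⟨
  + (k + n)              ∎)
  where
  i≡[i-j]+j : ∀ i j → i ≡ (i ℤ.- j) ℤ.+ j
  i≡[i-j]+j = ℤ-Solver.solve-∀

data SignedBezout (a b w : ℕ) : Set where
  negative-u : ∀ m → b * w ≡ 1 + a * suc m → SignedBezout a b w
  negative-v : ∀ m → a * suc m ≡ 1 + b * w → SignedBezout a b w

mixed-sign-bezout : ∀ a b m n → + a ℤ.* + m ℤ.+ + b ℤ.* -[1+ n ] ≡ + 1 → a * m ≡ 1 + b * suc n
mixed-sign-bezout a b m n eq =
  m-n≡k⇒m≡k+n _ _ 1 (trans (cong₂ ℤ._+_ (ℤ.pos-* a m) (sym (+*-[1+] b n))) eq)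

-[k]≢1 : ∀ k → ℤ.- + k ≢ + 1
-[k]≢1 zero    ()
-[k]≢1 (suc k) ()

signed-bezout : ∀ {a b} → 1 < a → 1 < b → ∀ u v →
               + a ℤ.* u ℤ.+ + b ℤ.* v ≡ + 1 → SignedBezout a b ∣ v ∣
signed-bezout {a} {b} 1<a 1<b (+ m) (+ w) eq = ⊥-elim (no-nonnegative m w (ℤ.+-injective (begin
  + (a * m + b * w)            ≡⟨ ℤ.pos-+ (a * m) (b * w) ⟩
  + (a * m) ℤ.+ + (b * w)      ≡⟨ cong₂ ℤ._+_ (ℤ.pos-* a m) (ℤ.pos-* b w) ⟩
  + a ℤ.* + m ℤ.+ + b ℤ.* + w  ≡⟨ eq ⟩
  + 1                          ∎)))
  where
  no-nonnegative : ∀ m w → a * m + b * w ≢ 1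
  no-nonnegative zero    zero    e = 0≢1+n (trans (sym (cong₂ _+_ (*-zeroʳ a) (*-zeroʳ b))) e)
  no-nonnegative (suc m) w       e = <⇒≱ 1<a (≤-trans (m≤m*n a (suc m)) (≤-trans (m≤m+n _ _) (≤-reflexive e)))
  no-nonnegative zero    (suc w) e = <⇒≱ 1<b (≤-trans (m≤m*n b (suc w)) (≤-trans (m≤n+m _ _) (≤-reflexive e)))
signed-bezout {a} {b} _ _ (+ zero) -[1+ n ] eq =
  ⊥-elim (0≢1+n (trans (sym (*-zeroʳ a)) (mixed-sign-bezout a b 0 n eq)))
signed-bezout {a} {b} _ _ (+ suc m) -[1+ n ] eq = negative-v m (mixed-sign-bezout a b (suc m) n eq)
signed-bezout {a} {b} _ _ -[1+ m ] (+ w) eq =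
  negative-u m (mixed-sign-bezout b a w m (trans (ℤ.+-comm (+ b ℤ.* + w) (+ a ℤ.* -[1+ m ])) eq))
signed-bezout {a} {b} _ _ -[1+ m ] -[1+ n ] eq = ⊥-elim (-[k]≢1 (a * suc m + b * suc n) (begin
  ℤ.- + (a * suc m + b * suc n)                 ≡⟨ cong ℤ.-_ (ℤ.pos-+ (a * suc m) (b * suc n)) ⟩
  ℤ.- (+ (a * suc m) ℤ.+ + (b * suc n))         ≡⟨ ℤ.neg-distrib-+ (+ (a * suc m)) (+ (b * suc n)) ⟩
  ℤ.- + (a * suc m) ℤ.+ ℤ.- + (b * suc n)       ≡⟨ cong₂ ℤ._+_ (+*-[1+] a m) (+*-[1+] b n) ⟨
  + a ℤ.* -[1+ m ] ℤ.+ + b ℤ.* -[1+ n ]         ≡⟨ eq ⟩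
  + 1                                           ∎))

m≤∣m⊖n∣⇒m+m≤n : ∀ {m n} → 0 < n → m ≤ ∣ m ⊖ n ∣ → m + m ≤ n
m≤∣m⊖n∣⇒m+m≤n {m} {n} 0<n m≤∣m⊖n∣ with m ≤? n
... | yes m≤n = subst (m + m ≤_) (m+[n∸m]≡n m≤n) (+-monoʳ-≤ m (≤-trans m≤∣m⊖n∣ (≤-reflexive
  (trans (cong ∣_∣ (ℤ.⊖-≤ m≤n)) (ℤ.∣-i∣≡∣i∣ (+ (n ∸ m)))))))
... | no m≰n = contradiction m≤∣m⊖n∣ (<⇒≱ (subst (_< m) (cong ∣_∣ (sym (ℤ.⊖-≥ n≤m))) (∸-monoʳ-< 0<n n≤m)))
  where n≤m = <⇒≤ (≰⇒> m≰n)

∣v∣+∣v∣≤a : ∀ {a} v → 0 < a → ∣ v ∣ ≤ ∣ v ℤ.- + a ∣ → ∣ v ∣ ≤ ∣ v ℤ.+ + a ∣ → ∣ v ∣ + ∣ v ∣ ≤ a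
∣v∣+∣v∣≤a {a} (+ w) 0<a closer _ =
  m≤∣m⊖n∣⇒m+m≤n 0<a (subst (λ i → w ≤ ∣ i ∣) (ℤ.m-n≡m⊖n w a) closer)
∣v∣+∣v∣≤a {a} -[1+ n ] 0<a _ closer = m≤∣m⊖n∣⇒m+m≤n 0<a
  (subst (suc n ≤_) (trans (cong ∣_∣ (ℤ.-m+n≡n⊖m (suc n) a)) (ℤ.∣m⊖n∣≡∣n⊖m∣ a (suc n))) closer)

definitelyLeast⇒∣v∣+∣v∣≤a : ∀ {a b u v} → 0 < a → DefinitelyLeast a b u v → ∣ v ∣ + ∣ v ∣ ≤ a
definitelyLeast⇒∣v∣+∣v∣≤a {a} {b} {u} {v} 0<a (bezout , least) = ∣v∣+∣v∣≤a v 0<a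
  (proj₂ (least (u ℤ.+ + b) (v ℤ.- + a) (trans (shift⁺ (+ a) (+ b) u v) bezout)))
  (proj₂ (least (u ℤ.- + b) (v ℤ.+ + a) (trans (shift⁻ (+ a) (+ b) u v) bezout)))
  where
  shift⁺ : ∀ a b u v → a ℤ.* (u ℤ.+ b) ℤ.+ b ℤ.* (v ℤ.- a) ≡ a ℤ.* u ℤ.+ b ℤ.* v
  shift⁺ = ℤ-Solver.solve-∀
  shift⁻ : ∀ a b u v → a ℤ.* (u ℤ.- b) ℤ.+ b ℤ.* (v ℤ.+ a) ≡ a ℤ.* u ℤ.+ b ℤ.* v
  shift⁻ = ℤ-Solver.solve-∀

[m+n]%d≡m%d⇒d∣n : ∀ {d} .{{_ : NonZero d}} m n → (m + n) % d ≡ m % d → d ∣ n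
[m+n]%d≡m%d⇒d∣n {d} m n eq = ∣m+n∣m⇒∣n (divides ((m + n) / d) q*d+n≡) (n∣m*n (m / d))
  where
  q*d+n≡ : m / d * d + n ≡ (m + n) / d * d
  q*d+n≡ = +-cancelˡ-≡ (m % d) _ _ (begin
    m % d + (m / d * d + n)        ≡⟨ +-assoc (m % d) _ n ⟨
    m % d + m / d * d + n          ≡⟨ cong (_+ n) (m≡m%n+[m/n]*n m d) ⟨
    m + n                          ≡⟨ m≡m%n+[m/n]*n (m + n) d ⟩
    (m + n) % d + (m + n) / d * d  ≡⟨ cong (_+ (m + n) / d * d) eq ⟩
    m % d + (m + n) / d * d        ∎)

[k*n+i]%n≡i : ∀ {n} .{{_ : NonZero n}} k {i} → i < n → (k * n + i) % n ≡ i
[k*n+i]%n≡i {n} k {i} i<n = begin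
  (k * n + i) % n  ≡⟨ cong (_% n) (+-comm (k * n) i) ⟩
  (i + k * n) % n  ≡⟨ [m+kn]%n≡m%n i k n ⟩
  i % n            ≡⟨ m<n⇒m%n≡m i<n ⟩
  i                ∎

applyUpTo-hasCard : ∀ {P : ℕ → Set} (f : ℕ → ℕ) n →
                    (∀ {i j} → i < j → j < n → f i ≢ f j) →
                    (∀ {r} → r < n → P (f r)) →
                    (∀ {x} → P x → ∃ λ r → r < n × x ≡ f r) →
                    HasCard P n
applyUpTo-hasCard {P} f n distinct sound complete =
  applyUpTo f n , applyUpTo⁺₁ f n distinct , (λ _ → mk⇔ to from) , length-applyUpTo f n
  where
  to : ∀ {x} → x ∈ applyUpTo f n → P x
  to x∈ with ∈-applyUpTo⁻ f x∈
  ... | r , r<n , refl = sound r<n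
  from : ∀ {x} → P x → x ∈ applyUpTo f n
  from Px with complete Px
  ... | r , r<n , refl = ∈-applyUpTo⁺ f r<n

module TopGaps (a b : ℕ) .{{_ : NonZero a}} (coprime : Coprime a b) (a<b : a < b) where

  instance
    b≢0 : NonZero b
    b≢0 = >-nonZero (<-trans (>-nonZero⁻¹ a) a<b)

  res : ℕ → ℕ
  res t = t * b % a

  a∣x*b⇒x≡0 : ∀ {x} → x < a → a ∣ x * b → x ≡ 0
  a∣x*b⇒x≡0 {x} x<a a∣xb = trans (sym (m<n⇒m%n≡m x<a))
    (n∣m⇒m%n≡0 x a (coprime-divisor coprime (subst (a ∣_) (*-comm x b) a∣xb)))

  res-injective-≤ : ∀ {t u} → t ≤ u → u < a → res u ≡ res t → t ≡ u
  res-injective-≤ {t} t≤u u<a eq with m≤n⇒∃[o]m+o≡n t≤u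
  ... | d , refl = sym (trans (cong (λ x → t + x) d≡0) (+-identityʳ t))
    where
    d≡0 : d ≡ 0
    d≡0 = a∣x*b⇒x≡0 (≤-<-trans (m≤n+m d t) u<a)
      ([m+n]%d≡m%d⇒d∣n (t * b) (d * b) (trans (cong (_% a) (sym (*-distribʳ-+ b t d))) eq))

  res-injective : ∀ {t₁ t₂} → t₁ < a → t₂ < a → res t₁ ≡ res t₂ → t₁ ≡ t₂
  res-injective {t₁} {t₂} t₁<a t₂<a eq with ≤-total t₁ t₂
  ... | inj₁ t₁≤t₂ = res-injective-≤ t₁≤t₂ t₂<a (sym eq)
  ... | inj₂ t₂≤t₁ = sym (res-injective-≤ t₂≤t₁ t₁<a eq)

  res-positive : ∀ {t} → 0 < t → t < a → 0 < res t
  res-positive {t} 0<t t<a = n≢0⇒n>0 λ res≡0 →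
    <⇒≢ 0<t (sym (a∣x*b⇒x≡0 t<a (m%n≡0⇒n∣m (t * b) a res≡0)))

  top-gap : ∀ {t} → 0 < t → ∃ λ k → k * a + res t + a ≡ t * b
  top-gap {t} 0<t = k , (begin
    k * a + res t + a          ≡⟨ shuffle k (res t) a ⟩
    res t + (1 + k) * a        ≡⟨ cong (λ q → res t + q * a) (m/n≡1+[m∸n]/n a≤tb) ⟨
    res t + t * b / a * a      ≡⟨ m≡m%n+[m/n]*n (t * b) a ⟨
    t * b                      ∎)
    where
    k = (t * b ∸ a) / a
    a≤tb : a ≤ t * b
    a≤tb = ≤-trans (<⇒≤ a<b) (m≤n*m b t {{>-nonZero 0<t}})
    shuffle : ∀ k r a → k * a + r + a ≡ r + (1 + k) * a
    shuffle = solve-∀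

  top-gap∉S : ∀ {s t} → t < a → s + a ≡ t * b → ¬ InS a b s
  top-gap∉S {s} {t} t<a s+a≡tb (l₁ , l₂ , E) = no-extra-b (m≤n⇒∃[o]m+o≡n l₂≤t)
    where
    E′ : l₂ * b + suc l₁ * a ≡ t * b
    E′ = begin
      l₂ * b + suc l₁ * a  ≡⟨ solve (l₁ ∷ l₂ ∷ a ∷ b ∷ []) ⟩
      l₁ * a + l₂ * b + a  ≡⟨ cong (_+ a) E ⟩
      s + a                ≡⟨ s+a≡tb ⟩
      t * b                ∎
    l₂≤t : l₂ ≤ t
    l₂≤t = *-cancelʳ-≤ l₂ t b (subst (l₂ * b ≤_) E′ (m≤m+n _ _))
    no-extra-b : ¬ ∃ λ d → l₂ + d ≡ t
    no-extra-b (d , l₂+d≡t) = ≢-nonZero⁻¹ a (m+n≡0⇒m≡0 a (trans (sym db≡) (cong (_* b) d≡0)))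
      where
      db≡ : d * b ≡ suc l₁ * a
      db≡ = +-cancelˡ-≡ (l₂ * b) _ _ (begin
        l₂ * b + d * b       ≡⟨ *-distribʳ-+ b l₂ d ⟨
        (l₂ + d) * b         ≡⟨ cong (_* b) l₂+d≡t ⟩
        t * b                ≡⟨ E′ ⟨
        l₂ * b + suc l₁ * a  ∎)
      d≡0 : d ≡ 0
      d≡0 = a∣x*b⇒x≡0 (≤-<-trans (subst (d ≤_) l₂+d≡t (m≤n+m d l₂)) t<a) (divides (suc l₁) db≡)

  res-of-shift : ∀ {s t K} → s + b * a ≡ t * b + K * a → s % a ≡ res t
  res-of-shift {s} {t} {K} eq = begin
    s % a                 ≡⟨ [m+kn]%n≡m%n s b a ⟨
    (s + b * a) % a       ≡⟨ cong (_% a) eq ⟩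
    (t * b + K * a) % a   ≡⟨ [m+kn]%n≡m%n (t * b) K a ⟩
    res t                 ∎

-- c = a − w and e = a − 2w, so that 2w ≤ a is built into the parameters
module IsolatedGaps (a b : ℕ) .{{_ : NonZero a}} (coprime : Coprime a b) (a<b : a < b)
                    {c w e : ℕ} (a≡c+w : a ≡ c + w) (c≡w+e : c ≡ w + e) where

  open TopGaps a b coprime a<b

  [c+r]b≡bw+[e+r]b : ∀ r → (c + r) * b ≡ b * w + (e + r) * b
  [c+r]b≡bw+[e+r]b r = begin
    (c + r) * b          ≡⟨ cong (λ x → (x + r) * b) c≡w+e ⟩
    (w + e + r) * b      ≡⟨ solve (w ∷ e ∷ r ∷ b ∷ []) ⟩
    b * w + (e + r) * b  ∎

  [c+r]b+bw≡rb+ba : ∀ r → (c + r) * b + b * w ≡ r * b + b * a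
  [c+r]b+bw≡rb+ba r = begin
    (c + r) * b + b * w  ≡⟨ solve (c ∷ r ∷ b ∷ w ∷ []) ⟩
    r * b + b * (c + w)  ≡⟨ cong (λ x → r * b + b * x) a≡c+w ⟨
    r * b + b * a        ∎

  0<c : 0 < c
  0<c = n≢0⇒n>0 λ c≡0 → ≢-nonZero⁻¹ a (begin
    a      ≡⟨ a≡c+w ⟩
    c + w  ≡⟨ cong₂ _+_ c≡0 (m+n≡0⇒m≡0 w (trans (sym c≡w+e) c≡0)) ⟩
    0      ∎)

  c+r<a : ∀ {r} → r < w → c + r < a
  c+r<a r<w = subst (_ <_) (sym a≡c+w) (+-monoʳ-< c r<w)

  1+m<b : ∀ m → a * suc m ≤ 1 + b * w → suc m < b
  1+m<b m a[1+m]≤1+bw = *-cancelˡ-< a (suc m) b (≤-<-trans a[1+m]≤1+bw 1+bw<ab)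
    where
    1+bw<ab : 1 + b * w < a * b
    1+bw<ab = <-≤-trans (+-monoˡ-< (b * w) (≤-<-trans (>-nonZero⁻¹ a) a<b))
      (≤-trans (≤-reflexive (sym (*-suc b w)))
      (≤-trans (*-monoʳ-≤ b (subst (w <_) (sym a≡c+w) (m<n+m w 0<c))) (≤-reflexive (*-comm b a))))

  module NegativeU (m : ℕ) (bw≡1+a[1+m] : b * w ≡ 1 + a * suc m) where

    2+m≤b : suc (suc m) ≤ b
    2+m≤b = 1+m<b m (≤-trans (m≤n+m _ 1) (≤-trans (≤-reflexive (sym bw≡1+a[1+m])) (m≤n+m _ 1)))

    top-gap-pred : ∀ {r s} → s + a ≡ (c + r) * b → ∃ λ y → s ≡ suc y × InS a b y
    top-gap-pred {r} {s} s+a≡ = _ , +-cancelʳ-≡ a _ _ (begin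
      s + a                          ≡⟨ s+a≡ ⟩
      (c + r) * b                    ≡⟨ [c+r]b≡bw+[e+r]b r ⟩
      b * w + (e + r) * b            ≡⟨ cong (_+ (e + r) * b) bw≡1+a[1+m] ⟩
      1 + a * suc m + (e + r) * b    ≡⟨ solve (a ∷ m ∷ e ∷ r ∷ b ∷ []) ⟩
      suc (m * a + (e + r) * b) + a  ∎) , (m , e + r , refl)

    top-gap-suc : ∀ {r s} → s + a ≡ (c + r) * b → InS a b (suc s)
    top-gap-suc {r} {s} s+a≡ with m≤n⇒∃[o]m+o≡n 2+m≤b
    ... | d , 2+m+d≡b = d , r , +-cancelʳ-≡ (a * suc (suc m)) _ _ (begin
      d * a + r * b + a * suc (suc m)    ≡⟨ solve (d ∷ a ∷ r ∷ b ∷ m ∷ []) ⟩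
      r * b + (suc (suc m) + d) * a      ≡⟨ cong (λ x → r * b + x * a) 2+m+d≡b ⟩
      r * b + b * a                      ≡⟨ [c+r]b+bw≡rb+ba r ⟨
      (c + r) * b + b * w                ≡⟨ cong₂ _+_ s+a≡ (sym bw≡1+a[1+m]) ⟨
      s + a + (1 + a * suc m)            ≡⟨ solve (s ∷ a ∷ m ∷ []) ⟩
      suc s + a * suc (suc m)            ∎)

    top-gap-isolated : ∀ {r s} → r < w → s + a ≡ (c + r) * b → IsolatedGap a b s
    top-gap-isolated r<w s+a≡ = top-gap∉S (c+r<a r<w) s+a≡ , top-gap-pred s+a≡ , top-gap-suc s+a≡

    -- subtracting 1 = b w − a (m + 1) keeps us inside ⟨a,b⟩ once the coefficient of b is ≥ w
    pred∈S : ∀ {l₁ l₂ s} → w ≤ l₂ → l₁ * a + l₂ * b ≡ suc s → InS a b s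
    pred∈S {l₁} {l₂} {s} w≤l₂ E with m≤n⇒∃[o]m+o≡n w≤l₂
    ... | g , refl = l₁ + suc m , g , suc-injective (begin
      suc ((l₁ + suc m) * a + g * b)   ≡⟨ solve (l₁ ∷ m ∷ a ∷ g ∷ b ∷ []) ⟩
      l₁ * a + (1 + a * suc m) + g * b ≡⟨ cong (λ x → l₁ * a + x + g * b) bw≡1+a[1+m] ⟨
      l₁ * a + b * w + g * b           ≡⟨ solve (l₁ ∷ a ∷ b ∷ w ∷ g ∷ []) ⟩
      l₁ * a + (w + g) * b             ≡⟨ E ⟩
      suc s                            ∎)

    isolated-gap-class : ∀ {s} → IsolatedGap a b s → ∃ λ r → r < w × s % a ≡ res (c + r)
    isolated-gap-class {s} (s∉S , _ , (l₁ , l₂ , E)) with w ≤? l₂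
    ... | yes w≤l₂ = contradiction (pred∈S {l₁} w≤l₂ E) s∉S
    ... | no  w≰l₂ = l₂ , ≰⇒> w≰l₂ , res-of-shift {t = c + l₂} {K = l₁ + suc m} (suc-injective (begin
      suc s + b * a                               ≡⟨ cong (_+ b * a) E ⟨
      l₁ * a + l₂ * b + b * a                     ≡⟨ +-assoc (l₁ * a) (l₂ * b) (b * a) ⟩
      l₁ * a + (l₂ * b + b * a)                   ≡⟨ cong (λ x → l₁ * a + x) ([c+r]b+bw≡rb+ba l₂) ⟨
      l₁ * a + ((c + l₂) * b + b * w)             ≡⟨ cong (λ x → l₁ * a + ((c + l₂) * b + x)) bw≡1+a[1+m] ⟩
      l₁ * a + ((c + l₂) * b + (1 + a * suc m))   ≡⟨ solve (l₁ ∷ a ∷ c ∷ l₂ ∷ b ∷ m ∷ []) ⟩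
      suc ((c + l₂) * b + (l₁ + suc m) * a)       ∎))

  module NegativeV (m : ℕ) (a[1+m]≡1+bw : a * suc m ≡ 1 + b * w) where

    2+m≤b : suc (suc m) ≤ b
    2+m≤b = 1+m<b m (≤-reflexive a[1+m]≡1+bw)

    top-gap-pred : ∀ {r s} → s + a ≡ (c + r) * b → ∃ λ y → s ≡ suc y × InS a b y
    top-gap-pred {r} {s} s+a≡ with m≤n⇒∃[o]m+o≡n 2+m≤b
    ... | d , 2+m+d≡b = _ , +-cancelʳ-≡ (a * suc (suc m)) _ _ (begin
      s + a * suc (suc m)                    ≡⟨ solve (s ∷ a ∷ m ∷ []) ⟩
      s + a + a * suc m                      ≡⟨ cong₂ _+_ s+a≡ a[1+m]≡1+bw ⟩
      (c + r) * b + (1 + b * w)              ≡⟨ solve (c ∷ r ∷ b ∷ w ∷ []) ⟩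
      suc ((c + r) * b + b * w)              ≡⟨ cong suc ([c+r]b+bw≡rb+ba r) ⟩
      suc (r * b + b * a)                    ≡⟨ cong (λ x → suc (r * b + x * a)) 2+m+d≡b ⟨
      suc (r * b + (suc (suc m) + d) * a)    ≡⟨ solve (r ∷ b ∷ m ∷ d ∷ a ∷ []) ⟩
      suc (d * a + r * b) + a * suc (suc m)  ∎) , (d , r , refl)

    top-gap-suc : ∀ {r s} → s + a ≡ (c + r) * b → InS a b (suc s)
    top-gap-suc {r} {s} s+a≡ = m , e + r , +-cancelʳ-≡ a _ _ (begin
      m * a + (e + r) * b + a      ≡⟨ solve (m ∷ a ∷ e ∷ r ∷ b ∷ []) ⟩
      a * suc m + (e + r) * b      ≡⟨ cong (_+ (e + r) * b) a[1+m]≡1+bw ⟩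
      suc (b * w + (e + r) * b)    ≡⟨ cong suc ([c+r]b≡bw+[e+r]b r) ⟨
      suc ((c + r) * b)            ≡⟨ cong suc s+a≡ ⟨
      suc s + a                    ∎)

    top-gap-isolated : ∀ {r s} → r < w → s + a ≡ (c + r) * b → IsolatedGap a b s
    top-gap-isolated r<w s+a≡ = top-gap∉S (c+r<a r<w) s+a≡ , top-gap-pred s+a≡ , top-gap-suc s+a≡

    -- adding 1 = a (m + 1) − b w keeps us inside ⟨a,b⟩ once the coefficient of b is ≥ w
    suc∈S : ∀ {l₁ l₂} → w ≤ l₂ → InS a b (suc (l₁ * a + l₂ * b))
    suc∈S {l₁} w≤l₂ with m≤n⇒∃[o]m+o≡n w≤l₂
    ... | g , refl = l₁ + suc m , g , (begin
      (l₁ + suc m) * a + g * b      ≡⟨ solve (l₁ ∷ m ∷ a ∷ g ∷ b ∷ []) ⟩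
      l₁ * a + g * b + a * suc m    ≡⟨ cong (λ x → l₁ * a + g * b + x) a[1+m]≡1+bw ⟩
      l₁ * a + g * b + (1 + b * w)  ≡⟨ solve (l₁ ∷ a ∷ g ∷ b ∷ w ∷ []) ⟩
      suc (l₁ * a + (w + g) * b)    ∎)

    isolated-gap-class : ∀ {s} → IsolatedGap a b s → ∃ λ r → r < w × s % a ≡ res (c + r)
    isolated-gap-class {s} (s∉S , (y , s≡1+y , (l₁ , l₂ , E)) , _) with w ≤? l₂
    ... | yes w≤l₂ = contradiction (subst (InS a b) s≡1+[l₁a+l₂b] (suc∈S {l₁} w≤l₂)) s∉S
      where s≡1+[l₁a+l₂b] = trans (cong suc E) (sym s≡1+y)
    ... | no  w≰l₂ = l₂ , ≰⇒> w≰l₂ , res-of-shift {t = c + l₂} {K = l₁ + suc m} (begin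
      s + b * a                              ≡⟨ cong (_+ b * a) (trans s≡1+y (cong suc (sym E))) ⟩
      suc (l₁ * a + l₂ * b) + b * a          ≡⟨ solve (l₁ ∷ a ∷ l₂ ∷ b ∷ []) ⟩
      suc (l₁ * a + (l₂ * b + b * a))        ≡⟨ cong (λ x → suc (l₁ * a + x)) ([c+r]b+bw≡rb+ba l₂) ⟨
      suc (l₁ * a + ((c + l₂) * b + b * w))  ≡⟨ solve (l₁ ∷ a ∷ c ∷ l₂ ∷ b ∷ w ∷ []) ⟩
      l₁ * a + (c + l₂) * b + (1 + b * w)    ≡⟨ cong (λ x → l₁ * a + (c + l₂) * b + x) a[1+m]≡1+bw ⟨
      l₁ * a + (c + l₂) * b + a * suc m      ≡⟨ solve (l₁ ∷ a ∷ c ∷ l₂ ∷ b ∷ m ∷ []) ⟩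
      (c + l₂) * b + (l₁ + suc m) * a        ∎)

  top-gap-isolated : SignedBezout a b w → ∀ {r s} → r < w → s + a ≡ (c + r) * b → IsolatedGap a b s
  top-gap-isolated (negative-u m eq) = NegativeU.top-gap-isolated m eq
  top-gap-isolated (negative-v m eq) = NegativeV.top-gap-isolated m eq

  isolated-gap-class : SignedBezout a b w →
                       ∀ {s} → IsolatedGap a b s → ∃ λ r → r < w × s % a ≡ res (c + r)
  isolated-gap-class (negative-u m eq) = NegativeU.isolated-gap-class m eq
  isolated-gap-class (negative-v m eq) = NegativeV.isolated-gap-class m eq

  isolated-classes : SignedBezout a b w → HasCard (λ i → (1 ≤ i × i < a) × IiaNonempty a b i) w
  isolated-classes bezout = applyUpTo-hasCard (λ r → res (c + r)) w distinct sound complete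
    where
    0<c+r : ∀ r → 0 < c + r
    0<c+r r = ≤-trans 0<c (m≤m+n c r)

    distinct : ∀ {i j} → i < j → j < w → res (c + i) ≢ res (c + j)
    distinct i<j j<w eq =
      <⇒≢ i<j (+-cancelˡ-≡ c _ _ (res-injective (c+r<a (<-trans i<j j<w)) (c+r<a j<w) eq))

    sound : ∀ {r} → r < w → (1 ≤ res (c + r) × res (c + r) < a) × IiaNonempty a b (res (c + r))
    sound {r} r<w with top-gap (0<c+r r)
    ... | k , k*a+res+a≡ =
      (res-positive (0<c+r r) (c+r<a r<w) , m%n<n _ a) ,
      (_ , top-gap-isolated bezout r<w k*a+res+a≡ , k , refl)

    complete : ∀ {i} → (1 ≤ i × i < a) × IiaNonempty a b i → ∃ λ r → r < w × i ≡ res (c + r)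
    complete {i} ((_ , i<a) , s , gap , k , refl) with isolated-gap-class bezout gap
    ... | r , r<w , s%a≡ = r , r<w , trans (sym ([k*n+i]%n≡i k i<a)) s%a≡

proposition3p9 : (a b : ℕ) → Coprime a b → 1 < a → a < b →
    (u v : ℤ) → DefinitelyLeast a b u v →
    HasCard (λ i → (1 ≤ i × i < a) × IiaNonempty a b i) ∣ v ∣
proposition3p9 a b coprime 1<a a<b u v least@(bezout , _) =
  IsolatedGaps.isolated-classes a b coprime a<b a≡c+w c≡w+e
    (signed-bezout 1<a (<-trans 1<a a<b) u v bezout)
  where
  0<a = <-trans z<s 1<a
  instance
    a≢0 : NonZero a
    a≢0 = >-nonZero 0<a
  w = ∣ v ∣
  2w≤a : w + w ≤ a
  2w≤a = definitelyLeast⇒∣v∣+∣v∣≤a {b = b} 0<a least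
  a≡c+w : a ≡ (a ∸ w) + w
  a≡c+w = sym (m∸n+n≡m (m+n≤o⇒m≤o w 2w≤a))
  c≡w+e : a ∸ w ≡ w + (a ∸ w ∸ w)
  c≡w+e = sym (m+[n∸m]≡n (subst (_≤ a ∸ w) (m+n∸n≡m w w) (∸-monoˡ-≤ w 2w≤a)))
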